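{- Let $q,q',n$ be integers with $q'\ge 2q+1$, $q>1$ and $n>1$. Let $S$ be an $\mathcal{OS}_q(n)$ of period $m$ with ring sequence $[s_0,\ldots,s_{m-1}]$ where $s_0=0$. Let $t_i=(-1)^{i+m-1}s'_i$ if $s'_i\neq0$ and $t_i=(-1)^{i+m-1}q$ (in $\mathbb{Z}_{q'}$) if $s'_i=0$, for $i=0,\ldots,m-1$. Let $U$ be the periodic sequence over $\mathbb{Z}_{q'}$ whose ring sequence is $$[s'_0,\ldots,s'_{m-1},\,-s'_0,\ldots,-s'_{m-1},\,t_0,\ldots,t_{m-1},\,-t_0,\ldots,-t_{m-1}]$$ (the concatenation of the ring sequences of $S''$, with ring sequence $[s'_0,\ldots,s'_{m-1},-s'_0,\ldots,-s'_{m-1}]$, and $T'$, with ring sequence $[t_0,\ldots,t_{m-1},-t_0,\ldots,-t_{m-1}]$). Then $U$ is an $\mathcal{SOS}_{q'}(n)$ of period $4m$ with $w_{q'}(U)=0$.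
   Context: For $x\in\mathbb{Z}_q$, $x'$ denotes the residue class in $\mathbb{Z}_{q'}$ of the unique integer in $\{0,\ldots,q-1\}$ representing $x$. A periodic sequence is described by its ring sequence (one period). Write $\mathbf{s}_n(i)=(s_i,\ldots,s_{i+n-1})$; for an $n$-tuple $\mathbf{u}$, $\mathbf{u}^R$ is its reverse and $-\mathbf{u}$ its entrywise negative. An $n$-window sequence of period $m$ is one where $\mathbf{s}_n(i)=\mathbf{s}_n(j)$ implies $i\equiv j\pmod m$. An $\mathcal{OS}_q(n)$ is an $n$-window sequence over $\mathbb{Z}_q$ with $\mathbf{s}_n(i)\neq\mathbf{s}_n(j)^R$ for all $i,j$; an $\mathcal{SOS}_q(n)$ is an $\mathcal{OS}_q(n)$ with additionally $\mathbf{s}_n(i)\neq-\mathbf{s}_n(j)^R$ for all $i,j$. The weight $w(U)$ of a sequence over $\mathbb{Z}_{q'}$ is the sum of the terms of its ring sequence, each treated as an integer in $[0,q'-1]$; $w_{q'}(U)=w(U)\bmod q'$. -}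

module Defs where

open import Data.Nat using (ℕ; zero; suc; _+_; _*_; _∸_; NonZero; >-nonZero; >-nonZero⁻¹)
open import Data.Nat.Properties using (<-≤-trans; ≤-trans; m≤m+n)
open import Data.Nat.DivMod using (_mod_; _%_)
open import Data.Fin using (Fin; toℕ)
open import Data.Vec using (Vec; lookup; tabulate; reverse; map; _++_; sum)
open import Data.Product using (_×_)
open import Relation.Binary.PropositionalEquality using (_≡_; _≢_)

-- Residue class in ℤ_{p} of a natural number.
-- Elements of ℤ_q are represented by Fin q.

-- x' : the residue class in ℤ_{q'} of the representative of x ∈ ℤ_q in {0..q-1}
lift' : ∀ {q} (q' : ℕ) .{{_ : NonZero q'}} → Fin q → Fin q'
lift' q' x = toℕ x mod q'

neg : ∀ {q} .{{_ : NonZero q}} → Fin q → Fin q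
neg {q} x = (q ∸ toℕ x) mod q

negPow : ∀ {q} .{{_ : NonZero q}} → ℕ → Fin q → Fin q
negPow zero    v = v
negPow (suc k) v = neg (negPow k v)

-- the periodic sequence with ring sequence r (of period m): s_i = r[i mod m]
seqAt : ∀ {A : Set} {m} .{{_ : NonZero m}} → Vec A m → ℕ → A
seqAt {m = m} r i = lookup r (i mod m)

window : ∀ {A : Set} {m} .{{_ : NonZero m}} → (n : ℕ) → Vec A m → ℕ → Vec A n
window n r i = tabulate (λ (k : Fin n) → seqAt r (i + toℕ k))

-- n-window sequence of period m (the period being the length of the ring sequence)
IsWindowSeq : ∀ {A : Set} {m} .{{_ : NonZero m}} → ℕ → Vec A m → Set
IsWindowSeq {m = m} n r =
  ∀ (i j : ℕ) → window n r i ≡ window n r j → i % m ≡ j % m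

IsOS : ∀ {q m} .{{_ : NonZero m}} → ℕ → Vec (Fin q) m → Set
IsOS n r = IsWindowSeq n r × (∀ (i j : ℕ) → window n r i ≢ reverse (window n r j))

IsSOS : ∀ {q m} .{{_ : NonZero q}} .{{_ : NonZero m}} → ℕ → Vec (Fin q) m → Set
IsSOS n r = IsOS n r × (∀ (i j : ℕ) → window n r i ≢ map neg (reverse (window n r j)))

weight : ∀ {q m} → Vec (Fin q) m → ℕ
weight r = sum (map toℕ r)

module Construction {q : ℕ} (q' : ℕ) .{{_ : NonZero q'}} {m : ℕ} .{{nzm : NonZero m}} (s : Vec (Fin q) m) where

  instance
    nz4m : NonZero ((m + m) + (m + m))
    nz4m = >-nonZero (<-≤-trans (>-nonZero⁻¹ m {{nzm}}) (≤-trans (m≤m+n m m) (m≤m+n (m + m) (m + m))))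

  s' : Vec (Fin q') m
  s' = map (lift' q') s

  base : Fin q' → Fin q'
  base Fin.zero    = q mod q'
  base (Fin.suc x) = Fin.suc x

  t : Vec (Fin q') m
  t = tabulate (λ i → negPow (toℕ i + m ∸ 1) (base (lookup s' i)))

  S'' : Vec (Fin q') (m + m)
  S'' = s' ++ map neg s'

  T' : Vec (Fin q') (m + m)
  T' = t ++ map neg t

  -- ring sequence of U (length 4m, written (m + m) + (m + m))
  U : Vec (Fin q') ((m + m) + (m + m))
  U = S'' ++ T'

-- Read each y ∈ ℤ_{q'} as a signed residue: zero, positive (1 … q) or negative
-- (q' − q … q' − 1); these ranges are disjoint because q' ≥ 2q + 1. Every term of U is
-- ±s'_i or ±t_i, so its magnitude, reduced mod q (which sends the substitute value q of t
-- back to 0), is s_i. Hence each window of U projects onto the window of S at the same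
-- index, and the reversal conditions for U follow from the one for S; in particular equal
-- windows of U start at positions congruent mod m. They also start in the same quarter of
-- U, because the signs tell the quarters apart: on s' and −s' they are ≥ 0 resp. ≤ 0, on
-- t and −t they never vanish and alternate (t ending positive), and every quarter starts
-- at index 0, where s vanishes. Two consecutive signs therefore determine the quarter,
-- except for s' against −s' on a run of zeros of S; such a run would cover a whole window
-- of S, a palindrome, which an OS does not have. Finally U is made of the pairs v, −v, so
-- q' divides its weight.
module Submission where

open import Algebra.Properties.CommutativeSemigroup using (interchange)
open import Data.Bool.Base using (Bool; true; false; if_then_else_)
open import Data.Empty using (⊥; ⊥-elim)
open import Data.Fin.Base as Fin using (Fin; toℕ; fromℕ<; splitAt)
open import Data.Fin.Properties
  using (toℕ-injective; toℕ-fromℕ<; toℕ<n; toℕ-↑ˡ; toℕ-↑ʳ; splitAt⁻¹-↑ˡ; splitAt⁻¹-↑ʳ)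
open import Data.Maybe.Base using (Maybe; just; nothing)
open import Data.Maybe.Properties using (≡-dec)
open import Data.Nat.Base
open import Data.Nat.DivMod
open import Data.Nat.Divisibility using (_∣_; divides; _∣0; ∣-refl; ∣m∣n⇒∣m+n; n∣m⇒m%n≡0)
open import Data.Nat.Properties
open import Data.Nat.Tactic.RingSolver using (solve-∀)
open import Data.Parity.Base using (0ℙ; toSign)
open import Data.Parity.Properties using (⁻¹-selfInverse; suc-homo-⁻¹; ⁻¹-homo-opposite; +-homo-+; p+p≡0ℙ)
open import Data.Product.Base using (Σ; _×_; _,_; proj₁; proj₂)
open import Data.Sign.Base using (Sign; opposite) renaming (+ to +ˢ; - to -ˢ)
import Data.Sign.Properties as Sign
open import Data.Sum.Base using (_⊎_; inj₁; inj₂)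
open import Data.Vec.Base using (Vec; []; _∷_; lookup; tabulate; map; reverse; replicate; _++_; sum)
open import Data.Vec.Properties
  using ( lookup∘tabulate; tabulate-cong; tabulate-∘; lookup-map; lookup-++ˡ; lookup-++ʳ
        ; map-++; sum-++; map-reverse; map-const; map-∘; map-cong )
open import Function.Base using (_∘_; const; id)
open import Relation.Binary.Definitions using (DecidableEquality)
open import Relation.Binary.PropositionalEquality
open import Relation.Nullary.Decidable using (Dec; yes; no; map′; _×-dec_; _⊎-dec_; _→-dec_; from-yes)
open import Relation.Nullary.Negation using (¬_; contradiction)

open import Defs

private variable
  A B : Set

[m+m]+[m+m]≡4m : ∀ m → (m + m) + (m + m) ≡ 4 * m
[m+m]+[m+m]≡4m = solve-∀

[m+m]+[m+j]≡3m+j : ∀ m j → (m + m) + (m + j) ≡ 3 * m + j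
[m+m]+[m+j]≡3m+j = solve-∀

toSign-parity-suc : ∀ k → toSign (parity (suc k)) ≡ opposite (toSign (parity k))
toSign-parity-suc k = trans (cong toSign (sym (⁻¹-selfInverse (suc-homo-⁻¹ k)))) (⁻¹-homo-opposite (parity k))

parity-double : ∀ k → parity (k + k) ≡ 0ℙ
parity-double k = trans (+-homo-+ k k) (p+p≡0ℙ (parity k))

suc-% : ∀ x n .{{_ : NonZero n}} → suc x % n ≡ suc (x % n) % n
suc-% x n = trans (%-distribˡ-+ 1 x n)
  (trans (cong (λ r → (1 % n + r) % n) (sym (m%n%n≡m%n x n))) (sym (%-distribˡ-+ 1 (x % n) n)))

module _ {m : ℕ} .{{_ : NonZero m}} where

  +-%-congˡ : ∀ k {a b} → a % m ≡ b % m → (k + a) % m ≡ (k + b) % m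
  +-%-congˡ k {a} {b} eq =
    trans (%-distribˡ-+ k a m) (trans (cong (λ r → (k % m + r) % m) eq) (sym (%-distribˡ-+ k b m)))

  suc-%-cases : ∀ x → suc (x % m) < m ⊎ suc (x % m) ≡ m
  suc-%-cases x = m≤n⇒m<n∨m≡n (m%n<n x m)

  suc-%-below : ∀ {x} → suc (x % m) < m → suc x % m ≡ suc (x % m)
  suc-%-below {x} below = trans (suc-% x m) (m<n⇒m%n≡m below)

  suc-%-wrap : ∀ {x} → suc (x % m) ≡ m → suc x % m ≡ 0
  suc-%-wrap {x} wrap = trans (suc-% x m) (trans (cong (_% m) wrap) (n%n≡0 m))

isZero : ∀ {k} → Fin k → Bool
isZero Fin.zero    = true
isZero (Fin.suc _) = false

isZero-true : ∀ {k} (y : Fin k) → isZero y ≡ true → toℕ y ≡ 0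
isZero-true Fin.zero _ = refl

isZero-toℕ : ∀ {k} (y : Fin k) → toℕ y ≡ 0 → isZero y ≡ true
isZero-toℕ Fin.zero _ = refl

lookup-++-split : ∀ {a b : ℕ} (u : Vec A a) (v : Vec A b) (p : Fin (a + b)) →
  Σ (Fin a) (λ i → toℕ p ≡ toℕ i × lookup (u ++ v) p ≡ lookup u i) ⊎
  Σ (Fin b) (λ j → toℕ p ≡ a + toℕ j × lookup (u ++ v) p ≡ lookup v j)
lookup-++-split {a = a} {b = b} u v p with splitAt a p in eq
... | inj₁ i = inj₁ (i , trans (cong toℕ (sym p≡)) (toℕ-↑ˡ i b) ,
                       trans (cong (lookup (u ++ v)) (sym p≡)) (lookup-++ˡ u v i))
  where p≡ = splitAt⁻¹-↑ˡ eq
... | inj₂ j = inj₂ (j , trans (cong toℕ (sym p≡)) (toℕ-↑ʳ a j) ,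
                       trans (cong (lookup (u ++ v)) (sym p≡)) (lookup-++ʳ u v j))
  where p≡ = splitAt⁻¹-↑ʳ eq

module _ {m : ℕ} .{{_ : NonZero m}} (r : Vec A m) where

  lookup≡seqAt : (j : Fin m) {c : ℕ} → toℕ j ≡ c % m → lookup r j ≡ seqAt r c
  lookup≡seqAt j eq = cong (lookup r) (toℕ-injective (trans eq (sym (toℕ-fromℕ< _))))

  lookup≡seqAt-toℕ : (j : Fin m) → lookup r j ≡ seqAt r (toℕ j)
  lookup≡seqAt-toℕ j = lookup≡seqAt j (sym (m<n⇒m%n≡m (toℕ<n j)))

  seqAt-cong : {a b : ℕ} → a % m ≡ b % m → seqAt r a ≡ seqAt r b
  seqAt-cong {a} eq = lookup≡seqAt (a mod m) (trans (toℕ-fromℕ< _) eq)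

  seqAt-% : (a : ℕ) → seqAt r (a % m) ≡ seqAt r a
  seqAt-% a = seqAt-cong (m%n%n≡m%n a m)

  lookup-window : ∀ n i (k : Fin n) → lookup (window n r i) k ≡ seqAt r (i + toℕ k)
  lookup-window n i k = lookup∘tabulate _ k

  window-≡⇒seqAt-≡ : ∀ {n i j k} → window n r i ≡ window n r j → k < n → seqAt r (i + k) ≡ seqAt r (j + k)
  window-≡⇒seqAt-≡ {n} {i} {j} eq k<n =
    subst (λ k → seqAt r (i + k) ≡ seqAt r (j + k)) (toℕ-fromℕ< k<n)
      (trans (sym (lookup-window n i _)) (trans (cong (λ w → lookup w (fromℕ< k<n)) eq) (lookup-window n j _)))

  constant-window-palindrome : ∀ {n i} (a : A) → (∀ {k} → k < n → seqAt r (i + k) ≡ a) →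
                               window n r i ≡ reverse (window n r i)
  constant-window-palindrome {n} {i} a constant = begin
    window n r i                          ≡⟨ w≡ ⟩
    map (const a) (tabulate id)           ≡⟨ map-const _ a ⟩
    replicate n a                         ≡⟨ map-const _ a ⟨
    map (const a) (reverse (tabulate id)) ≡⟨ map-reverse (const a) (tabulate id) ⟩
    reverse (map (const a) (tabulate id)) ≡⟨ cong reverse w≡ ⟨
    reverse (window n r i)                ∎
    where
    open ≡-Reasoning
    w≡ : window n r i ≡ map (const a) (tabulate id)
    w≡ = trans (tabulate-cong (λ k → constant (toℕ<n k))) (tabulate-∘ (const a) id)

map-window : ∀ {m m′} .{{_ : NonZero m}} .{{_ : NonZero m′}} (f : A → B) {r : Vec A m} {r′ : Vec B m′} →
             (∀ x → f (seqAt r x) ≡ seqAt r′ x) → ∀ n i → map f (window n r i) ≡ window n r′ i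
map-window f eq n i = trans (sym (tabulate-∘ f _)) (tabulate-cong (λ k → eq (i + toℕ k)))

weight-++ : ∀ {q a b} (u : Vec (Fin q) a) (v : Vec (Fin q) b) → weight (u ++ v) ≡ weight u + weight v
weight-++ u v = trans (cong sum (map-++ toℕ u v)) (sum-++ (map toℕ u))

module _ {Q : ℕ} .{{_ : NonZero Q}} where

  toℕ-neg-zero : (y : Fin Q) → toℕ y ≡ 0 → toℕ (neg y) ≡ 0
  toℕ-neg-zero y y≡0 = trans (toℕ-fromℕ< _) (trans (cong (λ a → (Q ∸ a) % Q) y≡0) (n%n≡0 Q))

  toℕ-neg-nonzero : (y : Fin Q) → 0 < toℕ y → toℕ (neg y) ≡ Q ∸ toℕ y
  toℕ-neg-nonzero y 0<y = trans (toℕ-fromℕ< _) (m<n⇒m%n≡m (∸-monoʳ-< 0<y (<⇒≤ (toℕ<n y))))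

  neg-involutive : (y : Fin Q) → neg (neg y) ≡ y
  neg-involutive Fin.zero = toℕ-injective (toℕ-neg-zero _ (toℕ-neg-zero Fin.zero refl))
  neg-involutive y@(Fin.suc _) = toℕ-injective (begin
    toℕ (neg (neg y)) ≡⟨ toℕ-neg-nonzero (neg y) (subst (0 <_) (sym neg-y≡) (m<n⇒0<n∸m (toℕ<n y))) ⟩
    Q ∸ toℕ (neg y)   ≡⟨ cong (Q ∸_) neg-y≡ ⟩
    Q ∸ (Q ∸ toℕ y)   ≡⟨ m∸[m∸n]≡n (<⇒≤ (toℕ<n y)) ⟩
    toℕ y             ∎)
    where
    open ≡-Reasoning
    neg-y≡ = toℕ-neg-nonzero y z<s

  negPow-suc-suc : ∀ k (v : Fin Q) → negPow (suc (suc k)) v ≡ negPow k v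
  negPow-suc-suc k v = neg-involutive (negPow k v)

  ∣toℕ+toℕ-neg : (y : Fin Q) → Q ∣ toℕ y + toℕ (neg y)
  ∣toℕ+toℕ-neg Fin.zero = subst (Q ∣_) (sym (toℕ-neg-zero Fin.zero refl)) (Q ∣0)
  ∣toℕ+toℕ-neg y@(Fin.suc _) =
    subst (Q ∣_) (sym (trans (cong (toℕ y +_) (toℕ-neg-nonzero y z<s)) (m+[n∸m]≡n (<⇒≤ (toℕ<n y))))) ∣-refl

  ∣weight-doubled : ∀ {k} (v : Vec (Fin Q) k) → Q ∣ weight (v ++ map neg v)
  ∣weight-doubled v = subst (Q ∣_) (sym (weight-++ v (map neg v))) (∣halves v)
    where
    ∣halves : ∀ {k} (v : Vec (Fin Q) k) → Q ∣ weight v + weight (map neg v)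
    ∣halves []      = Q ∣0
    ∣halves (y ∷ v) =
      subst (Q ∣_) (interchange +-commutativeSemigroup (toℕ y) (toℕ (neg y)) (weight v) (weight (map neg v)))
        (∣m∣n⇒∣m+n (∣toℕ+toℕ-neg y) (∣halves v))

module SignedResidues (q : ℕ) .{{_ : NonZero q}} (Q : ℕ) .{{_ : NonZero Q}} where

  -- |y| reduced mod q; it sends q to 0, undoing the substitution of q for 0 in t.
  magnitude : Fin Q → Fin q
  magnitude y = (toℕ y ⊓ (Q ∸ toℕ y)) mod q

  magnitude-neg : (y : Fin Q) → magnitude (neg y) ≡ magnitude y
  magnitude-neg Fin.zero = cong (λ a → (a ⊓ (Q ∸ a)) mod q) (toℕ-neg-zero Fin.zero refl)
  magnitude-neg y@(Fin.suc _) = cong (_mod q) (begin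
    toℕ (neg y) ⊓ (Q ∸ toℕ (neg y))  ≡⟨ cong (λ a → a ⊓ (Q ∸ a)) (toℕ-neg-nonzero y z<s) ⟩
    (Q ∸ toℕ y) ⊓ (Q ∸ (Q ∸ toℕ y))  ≡⟨ cong ((Q ∸ toℕ y) ⊓_) (m∸[m∸n]≡n (<⇒≤ (toℕ<n y))) ⟩
    (Q ∸ toℕ y) ⊓ toℕ y              ≡⟨ ⊓-comm (Q ∸ toℕ y) (toℕ y) ⟩
    toℕ y ⊓ (Q ∸ toℕ y)              ∎)
    where open ≡-Reasoning

  magnitude-negPow : ∀ k (v : Fin Q) → magnitude (negPow k v) ≡ magnitude v
  magnitude-negPow zero    v = refl
  magnitude-negPow (suc k) v = trans (magnitude-neg (negPow k v)) (magnitude-negPow k v)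

  IsPositive : Fin Q → Set
  IsPositive y = 0 < toℕ y × toℕ y ≤ q

  sign : Fin Q → Maybe Sign
  sign Fin.zero = nothing
  sign y@(Fin.suc _) with toℕ y ≤? q
  ... | yes _ = just +ˢ
  ... | no  _ = just -ˢ

  sign-zero : (y : Fin Q) → toℕ y ≡ 0 → sign y ≡ nothing
  sign-zero Fin.zero _ = refl

  sign-positive : (y : Fin Q) → IsPositive y → sign y ≡ just +ˢ
  sign-positive y@(Fin.suc _) (_ , y≤q) with toℕ y ≤? q
  ... | yes _   = refl
  ... | no  y≰q = contradiction y≤q y≰q

  sign-negative : (y : Fin Q) → q < toℕ y → sign y ≡ just -ˢ
  sign-negative y@(Fin.suc _) q<y with toℕ y ≤? q
  ... | yes y≤q = contradiction y≤q (<⇒≱ q<y)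
  ... | no  _   = refl

  module WideModulus (2q+1≤Q : 2 * q + 1 ≤ Q) where

    q<Q∸ : ∀ {a} → a ≤ q → q < Q ∸ a
    q<Q∸ {a} a≤q = m+n≤o⇒m≤o∸n (suc q) (≤-trans (s≤s (+-monoʳ-≤ q a≤q)) (subst (_≤ Q) 2q+1≡ 2q+1≤Q))
      where
      2q+1≡ : 2 * q + 1 ≡ suc (q + q)
      2q+1≡ = trans (+-comm (2 * q) 1) (cong (λ b → suc (q + b)) (+-identityʳ q))

    magnitude-small : (y : Fin Q) → toℕ y ≤ q → toℕ (magnitude y) ≡ toℕ y % q
    magnitude-small y y≤q =
      trans (toℕ-fromℕ< _) (cong (_% q) (m≤n⇒m⊓n≡m (<⇒≤ (≤-<-trans y≤q (q<Q∸ y≤q)))))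

    sign-neg-positive : (y : Fin Q) → IsPositive y → sign (neg y) ≡ just -ˢ
    sign-neg-positive y (0<y , y≤q) =
      sign-negative (neg y) (subst (q <_) (sym (toℕ-neg-nonzero y 0<y)) (q<Q∸ y≤q))

    sign-negPow : (b : Fin Q) → IsPositive b → ∀ k → sign (negPow k b) ≡ just (toSign (parity k))
    sign-negPow b b>0 zero          = sign-positive b b>0
    sign-negPow b b>0 (suc zero)    = sign-neg-positive b b>0
    sign-negPow b b>0 (suc (suc k)) = trans (cong sign (negPow-suc-suc k b)) (sign-negPow b b>0 k)

data Block : Set where
  S⁺ S⁻ T⁺ T⁻ : Block

index : Block → ℕ
index S⁺ = 0
index S⁻ = 1
index T⁺ = 2
index T⁻ = 3

next : Block → Block
next S⁺ = S⁻
next S⁻ = T⁺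
next T⁺ = T⁻
next T⁻ = S⁺

index<4 : ∀ R → index R < 4
index<4 S⁺ = s≤s z≤n
index<4 S⁻ = s≤s (s≤s z≤n)
index<4 T⁺ = s≤s (s≤s (s≤s z≤n))
index<4 T⁻ = s≤s (s≤s (s≤s (s≤s z≤n)))

index-injective : ∀ {R R′} → index R ≡ index R′ → R ≡ R′
index-injective {R} {R′} eq = trans (sym (block-index R)) (trans (cong block eq) (block-index R′))
  where
  block : ℕ → Block
  block 0 = S⁺
  block 1 = S⁻
  block 2 = T⁺
  block _ = T⁻
  block-index : ∀ R → block (index R) ≡ R
  block-index S⁺ = refl
  block-index S⁻ = refl
  block-index T⁺ = refl
  block-index T⁻ = refl

_≟ᴮ_ : DecidableEquality Block
R ≟ᴮ R′ = map′ index-injective (cong index) (index R ≟ index R′)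

∀-Bool? : {P : Bool → Set} → (∀ b → Dec (P b)) → Dec (∀ b → P b)
∀-Bool? P? = map′ (λ (t , f) → λ { true → t ; false → f }) (λ h → h true , h false) (P? true ×-dec P? false)

∀-Sign? : {P : Sign → Set} → (∀ σ → Dec (P σ)) → Dec (∀ σ → P σ)
∀-Sign? P? = map′ (λ (p , n) → λ { +ˢ → p ; -ˢ → n }) (λ h → h +ˢ , h -ˢ) (P? +ˢ ×-dec P? -ˢ)

∀-Block? : {P : Block → Set} → (∀ R → Dec (P R)) → Dec (∀ R → P R)
∀-Block? P? = map′ (λ (a , b , c , d) → λ { S⁺ → a ; S⁻ → b ; T⁺ → c ; T⁻ → d })
                   (λ h → h S⁺ , h S⁻ , h T⁺ , h T⁻) (P? S⁺ ×-dec P? S⁻ ×-dec P? T⁺ ×-dec P? T⁻)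

-- The sign of the term of block R at an offset where s vanishes iff z and t has sign τ.
expectedSign : Block → Bool → Sign → Maybe Sign
expectedSign S⁺ z τ = if z then nothing else just +ˢ
expectedSign S⁻ z τ = if z then nothing else just -ˢ
expectedSign T⁺ z τ = just τ
expectedSign T⁻ z τ = just (opposite τ)

SignsAgree : Block → Block → Bool → Sign → Set
SignsAgree R R′ z τ = expectedSign R z τ ≡ expectedSign R′ z τ

signsAgree? : ∀ R R′ z τ → Dec (SignsAgree R R′ z τ)
signsAgree? R R′ z τ = ≡-dec Sign._≟_ (expectedSign R z τ) (expectedSign R′ z τ)

OppositeSBlocks : Block → Block → Set
OppositeSBlocks R R′ = (R ≡ S⁺ × R′ ≡ S⁻) ⊎ (R ≡ S⁻ × R′ ≡ S⁺)

-- Signs at two consecutive offsets inside a block (where t flips sign), resp. at the last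
-- offset of a block (where t is positive) and the first of the next (where s vanishes).
interior-signs-determine-block : ∀ R R′ z₀ z₁ τ →
  SignsAgree R R′ z₀ τ → SignsAgree R R′ z₁ (opposite τ) → R ≡ R′ ⊎ OppositeSBlocks R R′
interior-signs-determine-block = from-yes
  (∀-Block? λ R → ∀-Block? λ R′ → ∀-Bool? λ z₀ → ∀-Bool? λ z₁ → ∀-Sign? λ τ →
     signsAgree? R R′ z₀ τ →-dec (signsAgree? R R′ z₁ (opposite τ) →-dec
       ((R ≟ᴮ R′) ⊎-dec (((R ≟ᴮ S⁺) ×-dec (R′ ≟ᴮ S⁻)) ⊎-dec ((R ≟ᴮ S⁻) ×-dec (R′ ≟ᴮ S⁺))))))

boundary-signs-determine-block : ∀ R R′ z τ →
  SignsAgree R R′ z +ˢ → SignsAgree (next R) (next R′) true τ → R ≡ R′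
boundary-signs-determine-block = from-yes
  (∀-Block? λ R → ∀-Block? λ R′ → ∀-Bool? λ z → ∀-Sign? λ τ →
     signsAgree? R R′ z +ˢ →-dec (signsAgree? (next R) (next R′) true τ →-dec (R ≟ᴮ R′)))

S⁺-S⁻-agree⇒zero : ∀ {z τ} → SignsAgree S⁺ S⁻ z τ → z ≡ true
S⁺-S⁻-agree⇒zero {true} _ = refl

S⁻-T⁺-disagree-at-zero : ∀ {τ} → ¬ SignsAgree S⁻ T⁺ true τ
S⁻-T⁺-disagree-at-zero ()

module ConstructionProperties (q Q m : ℕ) .{{_ : NonZero q}} .{{_ : NonZero Q}} .{{_ : NonZero m}}
  (2q+1≤Q : 2 * q + 1 ≤ Q) (s : Vec (Fin q) m) (s₀≡0 : toℕ (seqAt s 0) ≡ 0) where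

  open Construction Q s
  open SignedResidues q Q
  open WideModulus 2q+1≤Q
  open ≡-Reasoning

  N : ℕ
  N = (m + m) + (m + m)

  q<Q : q < Q
  q<Q = q<Q∸ z≤n

  toℕ-lift : (y : Fin q) → toℕ (lift' Q y) ≡ toℕ y
  toℕ-lift y = trans (toℕ-fromℕ< _) (m<n⇒m%n≡m (<-trans (toℕ<n y) q<Q))

  toℕ-q-mod-Q : toℕ (q mod Q) ≡ q
  toℕ-q-mod-Q = trans (toℕ-fromℕ< _) (m<n⇒m%n≡m q<Q)

  lift-positive : (y : Fin q) → 0 < toℕ y → IsPositive (lift' Q y)
  lift-positive y 0<y = subst (λ a → 0 < a × a ≤ q) (sym (toℕ-lift y)) (0<y , <⇒≤ (toℕ<n y))

  base-positive : (y : Fin q) → IsPositive (base (lift' Q y))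
  base-positive Fin.zero =
    subst (λ a → 0 < a × a ≤ q) (sym (base-of-zero _ (toℕ-lift Fin.zero))) (>-nonZero⁻¹ q , ≤-refl)
    where
    base-of-zero : (y : Fin Q) → toℕ y ≡ 0 → toℕ (base y) ≡ q
    base-of-zero Fin.zero _ = toℕ-q-mod-Q
  base-positive y@(Fin.suc _) = subst IsPositive (sym (base-of-nonzero _ (proj₁ lift-y>0))) lift-y>0
    where
    lift-y>0 = lift-positive y z<s
    base-of-nonzero : (y : Fin Q) → 0 < toℕ y → base y ≡ y
    base-of-nonzero (Fin.suc _) _ = refl

  magnitude-lift : (y : Fin q) → magnitude (lift' Q y) ≡ y
  magnitude-lift y = toℕ-injective (begin
    toℕ (magnitude (lift' Q y)) ≡⟨ magnitude-small _ (subst (_≤ q) (sym (toℕ-lift y)) (<⇒≤ (toℕ<n y))) ⟩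
    toℕ (lift' Q y) % q         ≡⟨ cong (_% q) (toℕ-lift y) ⟩
    toℕ y % q                   ≡⟨ m<n⇒m%n≡m (toℕ<n y) ⟩
    toℕ y                       ∎)

  magnitude-base : (y : Fin Q) → magnitude (base y) ≡ magnitude y
  magnitude-base Fin.zero = toℕ-injective (begin
    toℕ (magnitude (q mod Q)) ≡⟨ magnitude-small _ (≤-reflexive toℕ-q-mod-Q) ⟩
    toℕ (q mod Q) % q         ≡⟨ cong (_% q) toℕ-q-mod-Q ⟩
    q % q                     ≡⟨ n%n≡0 q ⟩
    0                         ≡⟨ m<n⇒m%n≡m (>-nonZero⁻¹ q) ⟨
    0 % q                     ≡⟨ magnitude-small Fin.zero z≤n ⟨
    toℕ (magnitude Fin.zero)  ∎)
  magnitude-base (Fin.suc _) = refl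

  sign-lift : ∀ (y : Fin q) τ → sign (lift' Q y) ≡ expectedSign S⁺ (isZero y) τ
  sign-lift Fin.zero      _ = sign-zero _ (toℕ-lift Fin.zero)
  sign-lift y@(Fin.suc _) _ = sign-positive _ (lift-positive y z<s)

  sign-neg-lift : ∀ (y : Fin q) τ → sign (neg (lift' Q y)) ≡ expectedSign S⁻ (isZero y) τ
  sign-neg-lift Fin.zero      _ = sign-zero _ (toℕ-neg-zero _ (toℕ-lift Fin.zero))
  sign-neg-lift y@(Fin.suc _) _ = sign-neg-positive _ (lift-positive y z<s)

  entry : Block → ℕ → Fin Q
  entry S⁺ x = seqAt s' x
  entry S⁻ x = neg (seqAt s' x)
  entry T⁺ x = seqAt t x
  entry T⁻ x = neg (seqAt t x)

  entry-% : ∀ R x → entry R (x % m) ≡ entry R x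
  entry-% S⁺ x = seqAt-% s' x
  entry-% S⁻ x = cong neg (seqAt-% s' x)
  entry-% T⁺ x = seqAt-% t x
  entry-% T⁻ x = cong neg (seqAt-% t x)

  s′-at : ∀ x → seqAt s' x ≡ lift' Q (seqAt s x)
  s′-at x = lookup-map (x mod m) (lift' Q) s

  tExponent : ℕ → ℕ
  tExponent x = x % m + m ∸ 1

  tSign : ℕ → Sign
  tSign x = toSign (parity (tExponent x))

  t-at : ∀ x → seqAt t x ≡ negPow (tExponent x) (base (lift' Q (seqAt s x)))
  t-at x = trans (lookup∘tabulate (λ i → negPow (toℕ i + m ∸ 1) (base (lookup s' i))) (x mod m))
                 (cong₂ (λ a b → negPow (a + m ∸ 1) (base b)) (toℕ-fromℕ< (m%n<n x m)) (s′-at x))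

  magnitude-entry : ∀ R x → magnitude (entry R x) ≡ seqAt s x
  magnitude-entry S⁺ x = trans (cong magnitude (s′-at x)) (magnitude-lift _)
  magnitude-entry S⁻ x = trans (magnitude-neg _) (magnitude-entry S⁺ x)
  magnitude-entry T⁺ x = begin
    magnitude (seqAt t x)                                         ≡⟨ cong magnitude (t-at x) ⟩
    magnitude (negPow (tExponent x) (base (lift' Q (seqAt s x)))) ≡⟨ magnitude-negPow (tExponent x) _ ⟩
    magnitude (base (lift' Q (seqAt s x)))                        ≡⟨ magnitude-base _ ⟩
    magnitude (lift' Q (seqAt s x))                               ≡⟨ magnitude-lift _ ⟩
    seqAt s x                                                     ∎
  magnitude-entry T⁻ x = trans (magnitude-neg _) (magnitude-entry T⁺ x)

  sign-entry : ∀ R x → sign (entry R x) ≡ expectedSign R (isZero (seqAt s x)) (tSign x)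
  sign-entry S⁺ x = trans (cong sign (s′-at x)) (sign-lift (seqAt s x) (tSign x))
  sign-entry S⁻ x = trans (cong (sign ∘ neg) (s′-at x)) (sign-neg-lift (seqAt s x) (tSign x))
  sign-entry T⁺ x = trans (cong sign (t-at x)) (sign-negPow _ (base-positive (seqAt s x)) (tExponent x))
  sign-entry T⁻ x = begin
    sign (neg (seqAt t x))                     ≡⟨ cong (sign ∘ neg) (t-at x) ⟩
    sign (negPow (suc (tExponent x)) _)        ≡⟨ sign-negPow _ (base-positive (seqAt s x)) (suc (tExponent x)) ⟩
    just (toSign (parity (suc (tExponent x)))) ≡⟨ cong just (toSign-parity-suc (tExponent x)) ⟩
    just (opposite (tSign x))                  ∎

  tSign-suc : ∀ {x} → suc (x % m) < m → tSign (suc x) ≡ opposite (tSign x)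
  tSign-suc {x} below = begin
    toSign (parity (suc x % m + m ∸ 1)) ≡⟨ cong (λ c → toSign (parity (c + m ∸ 1))) (suc-%-below below) ⟩
    toSign (parity (x % m + m))         ≡⟨ cong (toSign ∘ parity) (m+[n∸m]≡n 1≤x%m+m) ⟨
    toSign (parity (suc (tExponent x))) ≡⟨ toSign-parity-suc (tExponent x) ⟩
    opposite (tSign x)                  ∎
    where 1≤x%m+m = ≤-trans (>-nonZero⁻¹ m) (m≤n+m m (x % m))

  tSign-last : ∀ {x} → suc (x % m) ≡ m → tSign x ≡ +ˢ
  tSign-last {x} wrap = cong toSign (begin
    parity (x % m + m ∸ 1)   ≡⟨ cong (λ c → parity (c + m ∸ 1)) (cong (_∸ 1) wrap) ⟩
    parity (m ∸ 1 + m ∸ 1)   ≡⟨ cong parity (+-∸-assoc (m ∸ 1) (>-nonZero⁻¹ m)) ⟩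
    parity (m ∸ 1 + (m ∸ 1)) ≡⟨ parity-double (m ∸ 1) ⟩
    0ℙ                       ∎)

  s-vanishes-after-wrap : ∀ {x} → suc (x % m) ≡ m → isZero (seqAt s (suc x)) ≡ true
  s-vanishes-after-wrap wrap =
    isZero-toℕ _ (trans (cong toℕ (seqAt-cong s (trans (suc-%-wrap wrap) (sym 0%m≡0)))) s₀≡0)
    where 0%m≡0 = m<n⇒m%n≡m (>-nonZero⁻¹ m)

  record InBlock (x : ℕ) (R : Block) : Set where
    constructor inBlock
    field position : x % N ≡ index R * m + x % m

  quarter : (p : Fin N) →
    Σ Block λ R → Σ (Fin m) λ j → toℕ p ≡ index R * m + toℕ j × lookup U p ≡ entry R (toℕ j)
  quarter p with lookup-++-split S'' T' p
  ... | inj₁ (i , p≡i , Up≡Si) with lookup-++-split s' (map neg s') i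
  ...   | inj₁ (j , i≡j , Si≡) = S⁺ , j , trans p≡i i≡j , trans Up≡Si (trans Si≡ (lookup≡seqAt-toℕ s' j))
  ...   | inj₂ (j , i≡ , Si≡)  = S⁻ , j ,
    trans p≡i (trans i≡ (cong (_+ toℕ j) (sym (*-identityˡ m)))) ,
    trans Up≡Si (trans Si≡ (trans (lookup-map j neg s') (cong neg (lookup≡seqAt-toℕ s' j))))
  quarter p | inj₂ (i , p≡ , Up≡Ti) with lookup-++-split t (map neg t) i
  ...   | inj₁ (j , i≡j , Ti≡) = T⁺ , j ,
    trans p≡ (trans (cong ((m + m) +_) i≡j) (cong (λ a → (m + a) + toℕ j) (sym (*-identityˡ m)))) ,
    trans Up≡Ti (trans Ti≡ (lookup≡seqAt-toℕ t j))
  ...   | inj₂ (j , i≡ , Ti≡)  = T⁻ , j ,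
    trans p≡ (trans (cong ((m + m) +_) i≡) ([m+m]+[m+j]≡3m+j m (toℕ j))) ,
    trans Up≡Ti (trans Ti≡ (trans (lookup-map j neg t) (cong neg (lookup≡seqAt-toℕ t j))))

  locate : ∀ x → Σ Block λ R → InBlock x R × seqAt U x ≡ entry R x
  locate x with quarter (x mod N)
  ... | R , j , p≡ , Ux≡ =
    R , inBlock (trans x%N≡ (cong (index R * m +_) j≡x%m)) , trans Ux≡ (trans (cong (entry R) j≡x%m) (entry-% R x))
    where
    x%N≡ : x % N ≡ index R * m + toℕ j
    x%N≡ = trans (sym (toℕ-fromℕ< (m%n<n x N))) p≡
    j≡x%m : toℕ j ≡ x % m
    j≡x%m = begin
      toℕ j                     ≡⟨ m<n⇒m%n≡m (toℕ<n j) ⟨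
      toℕ j % m                 ≡⟨ [m+kn]%n≡m%n (toℕ j) (index R) m ⟨
      (toℕ j + index R * m) % m ≡⟨ cong (_% m) (+-comm (toℕ j) (index R * m)) ⟩
      (index R * m + toℕ j) % m ≡⟨ cong (_% m) x%N≡ ⟨
      x % N % m                 ≡⟨ m∣n⇒o%n%m≡o%m m N x (divides 4 ([m+m]+[m+m]≡4m m)) ⟩
      x % m                     ∎

  InBlock-unique : ∀ {x R R′} → InBlock x R → InBlock x R′ → R ≡ R′
  InBlock-unique {x} {R} {R′} (inBlock l) (inBlock l′) =
    index-injective (*-cancelʳ-≡ (index R) (index R′) m (+-cancelʳ-≡ (x % m) _ _ (trans (sym l) l′)))

  seqAt-U : ∀ {x R} → InBlock x R → seqAt U x ≡ entry R x
  seqAt-U {x} l with locate x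
  ... | R′ , l′ , Ux≡ = subst (λ R → seqAt U x ≡ entry R x) (InBlock-unique l′ l) Ux≡

  block-end≤N : ∀ R → index R * m + m ≤ N
  block-end≤N R = subst₂ _≤_ (+-comm m (index R * m)) (sym ([m+m]+[m+m]≡4m m)) (*-monoˡ-≤ m (index<4 R))

  next-block-start : ∀ R → (index R * m + m) % N ≡ index (next R) * m
  next-block-start R = trans (cong (_% N) (+-comm (index R * m) m)) (from-suc R)
    where
    start-below-N : ∀ R → index R * m % N ≡ index R * m
    start-below-N R = m<n⇒m%n≡m (<-≤-trans (m<m+n (index R * m) (>-nonZero⁻¹ m)) (block-end≤N R))
    from-suc : ∀ R → suc (index R) * m % N ≡ index (next R) * m
    from-suc S⁺ = start-below-N S⁻
    from-suc S⁻ = start-below-N T⁺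
    from-suc T⁺ = start-below-N T⁻
    from-suc T⁻ = trans (cong (_% N) (sym ([m+m]+[m+m]≡4m m))) (n%n≡0 N)

  suc-%N : ∀ {x R} → InBlock x R → suc x % N ≡ (index R * m + suc (x % m)) % N
  suc-%N {x} {R} (inBlock l) = trans (suc-% x N) (cong (_% N) (trans (cong suc l) (sym (+-suc (index R * m) (x % m)))))

  InBlock-suc : ∀ {x R} → InBlock x R → suc (x % m) < m → InBlock (suc x) R
  InBlock-suc {x} {R} l below = inBlock (begin
    suc x % N                       ≡⟨ suc-%N l ⟩
    (index R * m + suc (x % m)) % N ≡⟨ m<n⇒m%n≡m (<-≤-trans (+-monoʳ-< (index R * m) below) (block-end≤N R)) ⟩
    index R * m + suc (x % m)       ≡⟨ cong (index R * m +_) (suc-%-below below) ⟨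
    index R * m + suc x % m         ∎)

  InBlock-wrap : ∀ {x R} → InBlock x R → suc (x % m) ≡ m → InBlock (suc x) (next R)
  InBlock-wrap {x} {R} l wrap = inBlock (begin
    suc x % N                       ≡⟨ suc-%N l ⟩
    (index R * m + suc (x % m)) % N ≡⟨ cong (λ c → (index R * m + c) % N) wrap ⟩
    (index R * m + m) % N           ≡⟨ next-block-start R ⟩
    index (next R) * m              ≡⟨ +-identityʳ _ ⟨
    index (next R) * m + 0          ≡⟨ cong (index (next R) * m +_) (suc-%-wrap wrap) ⟨
    index (next R) * m + suc x % m  ∎)

  agree-signs : ∀ {x y R R′} → InBlock x R → InBlock y R′ → x % m ≡ y % m → seqAt U x ≡ seqAt U y →
                SignsAgree R R′ (isZero (seqAt s x)) (tSign x)
  agree-signs {x} {y} {R} {R′} lx ly x≡y Ux≡Uy = begin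
    expectedSign R (isZero (seqAt s x)) (tSign x)  ≡⟨ sign-entry R x ⟨
    sign (entry R x)                               ≡⟨ cong sign (trans (sym (seqAt-U lx)) (trans Ux≡Uy (seqAt-U ly))) ⟩
    sign (entry R′ y)                              ≡⟨ sign-entry R′ y ⟩
    expectedSign R′ (isZero (seqAt s y)) (tSign y) ≡⟨ cong₂ (expectedSign R′) (cong isZero (seqAt-cong s x≡y))
                                                            (cong (λ c → toSign (parity (c + m ∸ 1))) x≡y) ⟨
    expectedSign R′ (isZero (seqAt s x)) (tSign x) ∎

  module Windows {n : ℕ} (1<n : 1 < n) (os : IsOS n s) where

    -- Indexed as k + i rather than i + k so that suc k + i reduces to suc (k + i).
    Agree : ℕ → ℕ → Set
    Agree i j = ∀ {k} → k < n → seqAt U (k + i) ≡ seqAt U (k + j)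

    windows-agree : ∀ {i j} → window n U i ≡ window n U j → Agree i j
    windows-agree {i} {j} eq {k} k<n =
      subst₂ (λ a b → seqAt U a ≡ seqAt U b) (+-comm i k) (+-comm j k) (window-≡⇒seqAt-≡ U eq k<n)

    S⁺-S⁻-agreement-impossible : ∀ {i j} → Agree i j → i % m ≡ j % m → InBlock i S⁺ → InBlock j S⁻ → ⊥
    S⁺-S⁻-agreement-impossible {i} {j} agree i≡j li lj =
      proj₂ os i i (constant-window-palindrome s (seqAt s i) equals-first)
      where
      stays : ∀ {k} → k < n → InBlock (k + i) S⁺ × InBlock (k + j) S⁻
      stays {zero}  _     = li , lj
      stays {suc k} k+1<n with stays {k} (<-trans (n<1+n k) k+1<n) | suc-%-cases (k + i)
      ... | lk , lk′ | inj₁ below =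
        InBlock-suc lk below , InBlock-suc lk′ (subst (λ c → suc c < m) (+-%-congˡ k i≡j) below)
      ... | lk , lk′ | inj₂ wrap  = ⊥-elim (S⁻-T⁺-disagree-at-zero
        (subst (λ z → SignsAgree S⁻ T⁺ z _) (s-vanishes-after-wrap wrap)
          (agree-signs (InBlock-wrap lk wrap) (InBlock-wrap lk′ (subst (λ c → suc c ≡ m) (+-%-congˡ k i≡j) wrap))
                       (+-%-congˡ (suc k) i≡j) (agree k+1<n))))
      vanishes : ∀ {k} → k < n → toℕ (seqAt s (k + i)) ≡ 0
      vanishes {k} k<n = isZero-true _ (S⁺-S⁻-agree⇒zero {τ = tSign (k + i)}
        (agree-signs (proj₁ (stays k<n)) (proj₂ (stays k<n)) (+-%-congˡ k i≡j) (agree k<n)))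
      equals-first : ∀ {k} → k < n → seqAt s (i + k) ≡ seqAt s i
      equals-first {k} k<n = toℕ-injective
        (trans (cong (toℕ ∘ seqAt s) (+-comm i k)) (trans (vanishes k<n) (sym (vanishes (<-trans z<s 1<n)))))

    same-block : ∀ {i j R R′} → Agree i j → i % m ≡ j % m → InBlock i R → InBlock j R′ → R ≡ R′
    same-block {i} {j} {R} {R′} agree i≡j li lj with suc-%-cases i
    ... | inj₁ below =
      resolve (interior-signs-determine-block R R′ _ _ _ here (subst (SignsAgree R R′ _) (tSign-suc below) after))
      where
      here = agree-signs li lj i≡j (agree (<-trans z<s 1<n))
      after = agree-signs (InBlock-suc li below) (InBlock-suc lj (subst (λ c → suc c < m) i≡j below))
                          (+-%-congˡ 1 i≡j) (agree 1<n)
      resolve : R ≡ R′ ⊎ OppositeSBlocks R R′ → R ≡ R′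
      resolve (inj₁ R≡R′) = R≡R′
      resolve (inj₂ (inj₁ (R≡S⁺ , R′≡S⁻))) =
        ⊥-elim (S⁺-S⁻-agreement-impossible agree i≡j (subst (InBlock i) R≡S⁺ li) (subst (InBlock j) R′≡S⁻ lj))
      resolve (inj₂ (inj₂ (R≡S⁻ , R′≡S⁺))) =
        ⊥-elim (S⁺-S⁻-agreement-impossible (sym ∘ agree) (sym i≡j)
                  (subst (InBlock j) R′≡S⁺ lj) (subst (InBlock i) R≡S⁻ li))
    ... | inj₂ wrap = boundary-signs-determine-block R R′ _ _
      (subst (SignsAgree R R′ _) (tSign-last wrap) (agree-signs li lj i≡j (agree (<-trans z<s 1<n))))
      (subst (λ z → SignsAgree (next R) (next R′) z _) (s-vanishes-after-wrap wrap)
        (agree-signs (InBlock-wrap li wrap) (InBlock-wrap lj (subst (λ c → suc c ≡ m) i≡j wrap))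
                     (+-%-congˡ 1 i≡j) (agree 1<n)))

    magnitude-U : ∀ x → magnitude (seqAt U x) ≡ seqAt s x
    magnitude-U x with locate x
    ... | R , _ , Ux≡ = trans (cong magnitude Ux≡) (magnitude-entry R x)

    magnitude-window : ∀ i → map magnitude (window n U i) ≡ window n s i
    magnitude-window = map-window magnitude {U} {s} magnitude-U n

    magnitude-reverse-window : ∀ j → map magnitude (reverse (window n U j)) ≡ reverse (window n s j)
    magnitude-reverse-window j = trans (map-reverse magnitude (window n U j)) (cong reverse (magnitude-window j))

    project : ∀ {i w} → window n U i ≡ w → window n s i ≡ map magnitude w
    project {i} eq = trans (sym (magnitude-window i)) (cong (map magnitude) eq)

    U-isSOS : IsSOS n U
    U-isSOS = (isWindowSeq , reversal-free) , negated-reversal-free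
      where
      isWindowSeq : IsWindowSeq n U
      isWindowSeq i j eq with locate i | locate j
      ... | R , li , _ | R′ , lj , _ = begin
        i % N                ≡⟨ InBlock.position li ⟩
        index R * m + i % m  ≡⟨ cong₂ (λ B c → index B * m + c) (same-block (windows-agree eq) i≡j li lj) i≡j ⟩
        index R′ * m + j % m ≡⟨ InBlock.position lj ⟨
        j % N                ∎
        where i≡j = proj₁ os i j (trans (project eq) (magnitude-window j))
      reversal-free : ∀ i j → window n U i ≢ reverse (window n U j)
      reversal-free i j eq = proj₂ os i j (trans (project eq) (magnitude-reverse-window j))
      negated-reversal-free : ∀ i j → window n U i ≢ map neg (reverse (window n U j))
      negated-reversal-free i j eq = proj₂ os i j (begin
        window n s i                                     ≡⟨ project eq ⟩
        map magnitude (map neg (reverse (window n U j))) ≡⟨ map-∘ magnitude neg _ ⟨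
        map (magnitude ∘ neg) (reverse (window n U j))   ≡⟨ map-cong magnitude-neg _ ⟩
        map magnitude (reverse (window n U j))           ≡⟨ magnitude-reverse-window j ⟩
        reverse (window n s j)                           ∎)

weight-U : ∀ {q} Q .{{_ : NonZero Q}} {m} .{{_ : NonZero m}} (s : Vec (Fin q) m) →
           weight (Construction.U Q s) % Q ≡ 0
weight-U Q s = n∣m⇒m%n≡0 _ Q
  (subst (Q ∣_) (sym (weight-++ S'' T')) (∣m∣n⇒∣m+n (∣weight-doubled s') (∣weight-doubled t)))
  where open Construction Q s

corollary3p18 : (q q' n m : ℕ) .{{_ : NonZero q'}} .{{_ : NonZero m}} →
    2 * q + 1 ≤ q' → 1 < q → 1 < n →
    (s : Vec (Fin q) m) → IsOS n s → toℕ (seqAt s 0) ≡ 0 →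
    let open Construction q' s in
    IsSOS n U × (weight U % q' ≡ 0)
corollary3p18 q q' n m 2q+1≤q' 1<q 1<n s os s₀≡0 = U-isSOS , weight-U q' s
  where
  instance
    q-nonZero : NonZero q
    q-nonZero = >-nonZero (<-trans z<s 1<q)
  open ConstructionProperties q q' m 2q+1≤q' s s₀≡0
  open Windows 1<n os
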